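{- Every complete standard system that does not have weakening $(\mathsf W)$ among its rules contains $\mathbf{Pp}$.
   Context: Formulas are built from literals (propositional variables $P$ and their complements $\bar P$) using $\wedge$ and $\vee$. Negation satisfies $\neg P=\bar P$ and is extended by De Morgan's laws. A sequent is a nonempty finite multiset of formulas. A comma denotes multiset union, and $\Gamma,\Delta,\Sigma$ denote possibly empty multisets. A formula is valid if it evaluates to $1$ under every $0/1$-assignment. Rules: - Axiom: infer $P,\neg P$ from no premises. - $(\&)$: from $\Gamma,A$ and $\Gamma,B$ infer $\Gamma,A\wedge B$. - $(\otimes)$: from $\Delta,A$ and $\Sigma,B$ infer $\Delta,\Sigma,A\wedge B$. - $(\oplus)$: consists of both $(\oplus_1)$ and $(\oplus_2)$, where $(\oplus_i)$ infers $\Gamma,A_1\vee A_2$ from $\Gamma,A_i$. - $(\mathrm{par})$: from $\Gamma,A,B$ infer $\Gamma,A\vee B$. - $(\mathsf W)$: from $\Gamma$ infer $\Gamma,A$. - $(\mathsf C)$: from $\Gamma,A,A$ infer $\Gamma,A$. A standard system is the axiom together with any subset of $\{(\&),(\otimes),(\oplus),(\mathrm{par}),(\mathsf W),(\mathsf C)\}$. $\mathbf{Pp}$ is the axiom together with $(\otimes),(\oplus),(\mathsf C)$. A rule is derivable in $S$ if, for every instance of it, the conclusion is derivable in $S$ from its premises used as extra leaves. $S$ contains $T$ if every rule of $T$ is derivable in $S$. A system is complete if every valid formula is derivable in it. -}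

module Defs where

open import Data.Nat using (ℕ)
open import Data.Bool using (Bool; true; false; not; if_then_else_; _∧_; _∨_)
open import Data.List using (List; []; _∷_; _++_)
open import Data.List.Membership.Propositional using (_∈_)
open import Data.List.Relation.Binary.Permutation.Propositional using (_↭_)
open import Relation.Binary.PropositionalEquality using (_≡_)

-- Formulas: literals over propositional variables indexed by ℕ.
-- lit n true is the variable P_n, lit n false is its complement.
data Formula : Set where
  lit  : ℕ → Bool → Formula
  _⋀_  : Formula → Formula → Formula
  _⋁_  : Formula → Formula → Formula

infixr 6 _⋀_
infixr 5 _⋁_

neg : Formula → Formula
neg (lit n b) = lit n (not b)
neg (A ⋀ B)   = neg A ⋁ neg B
neg (A ⋁ B)   = neg A ⋀ neg B

eval : (ℕ → Bool) → Formula → Bool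
eval ρ (lit n b) = if b then ρ n else not (ρ n)
eval ρ (A ⋀ B)   = eval ρ A ∧ eval ρ B
eval ρ (A ⋁ B)   = eval ρ A ∨ eval ρ B

Valid : Formula → Set
Valid A = (ρ : ℕ → Bool) → eval ρ A ≡ true

-- Sequents: finite multisets, represented as lists up to permutation.
Sequent : Set
Sequent = List Formula

data Rule : Set where
  with-rule tensor plus par weak contr : Rule

-- A standard system: the axiom plus the rules r with S r ≡ true.
System : Set
System = Rule → Bool

data Instance : Rule → List Sequent → Sequent → Set where
  i-with   : ∀ Γ A B → Instance with-rule ((A ∷ Γ) ∷ (B ∷ Γ) ∷ []) ((A ⋀ B) ∷ Γ)
  i-tensor : ∀ Δ Σ A B → Instance tensor ((A ∷ Δ) ∷ (B ∷ Σ) ∷ []) ((A ⋀ B) ∷ (Δ ++ Σ))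
  i-plus₁  : ∀ Γ A₁ A₂ → Instance plus ((A₁ ∷ Γ) ∷ []) ((A₁ ⋁ A₂) ∷ Γ)
  i-plus₂  : ∀ Γ A₁ A₂ → Instance plus ((A₂ ∷ Γ) ∷ []) ((A₁ ⋁ A₂) ∷ Γ)
  i-par    : ∀ Γ A B → Instance par ((A ∷ B ∷ Γ) ∷ []) ((A ⋁ B) ∷ Γ)
  i-weak   : ∀ Γ A → Instance weak (Γ ∷ []) (A ∷ Γ)
  i-contr  : ∀ Γ A → Instance contr ((A ∷ A ∷ Γ) ∷ []) (A ∷ Γ)

-- Derivability in system S from extra leaves H (sequents are multisets,
-- so derivations are closed under permutation).
data AllDer (S : System) (H : List Sequent) : List Sequent → Set

data Der (S : System) (H : List Sequent) : Sequent → Set where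
  leaf  : ∀ {Γ} → Γ ∈ H → Der S H Γ
  perm  : ∀ {Γ Δ} → Γ ↭ Δ → Der S H Γ → Der S H Δ
  ax    : ∀ n → Der S H (lit n true ∷ lit n false ∷ [])
  rule  : ∀ {r prems concl} → S r ≡ true → Instance r prems concl →
          AllDer S H prems → Der S H concl

data AllDer S H where
  []  : AllDer S H []
  _∷_ : ∀ {Γ Γs} → Der S H Γ → AllDer S H Γs → AllDer S H (Γ ∷ Γs)

DerivableRule : System → Rule → Set
DerivableRule S r = ∀ prems concl → Instance r prems concl → Der S prems concl

-- S contains T: every rule of T is derivable in S (T's axiom is S's axiom).
Contains : System → System → Set
Contains S T = ∀ r → T r ≡ true → DerivableRule S r

Complete : System → Set
Complete S = ∀ A → Valid A → Der S [] (A ∷ [])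

Pp : System
Pp with-rule = false
Pp tensor    = true
Pp plus      = true
Pp par       = false
Pp weak      = false
Pp contr     = true

-- If ⊗, ⊕ or C were missing from a complete system S without W, some valid formula
-- would violate an invariant of the sequents derivable in S; so the rules of Pp are
-- primitive in S.
--   Without ⊗: the only rule building a conjunction, &, shares its context, so the only
--   derivable sequents of literals and DNFs whose terms pair two distinct literals
--   are the axioms; the DNF of all four minterms over P, Q is such a formula.
--   Without ⊕: no remaining rule drops or adds a literal, so the literals of a
--   derivable sequent are closed under negation, unlike those of P ∨ P̄ ∨ Q.
--   Without C: no rule lowers the number of literal occurrences, so a derivation of
--   F = P ∨ Q ∨ (P̄ ∧ P̄ ∧ Q̄), which has 5 of them, only passes through sequents of
--   subformulas of F of size at most 5.  Up to permutation the derivable ones are the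
--   axioms, (Q̄, Q ∨ P̄ ∧ P̄ ∧ Q̄) and (P, Q, P̄ ∧ Q̄): two occurrences of P̄ need two of P.

module Submission where

open import Defs
open import Data.Bool using (true; false)
open import Data.Bool.Properties using (¬-not; not-involutive)
open import Data.Empty using (⊥-elim)
open import Data.List using ([]; _∷_; _++_; [_]; map)
open import Data.List.Properties using (map-++; ∷-injectiveˡ)
open import Data.List.Membership.Propositional using (_∈_)
open import Data.List.Relation.Unary.All as All using (All; []; _∷_)
open import Data.List.Relation.Unary.All.Properties using (++⁻ˡ; ++⁻ʳ)
open import Data.List.Relation.Unary.Any using (Any; here; there; _─_)
open import Data.List.Relation.Unary.Any.Properties using (++⁺ˡ; ++⁺ʳ; ++⁻)
open import Data.List.Relation.Binary.Permutation.Propositional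
  using (_↭_; prep; swap; ↭-refl; ↭-sym; ↭-trans)
open import Data.List.Relation.Binary.Permutation.Propositional.Properties
  using (∈-resp-↭; drop-∷; ↭-singleton-inv; ↭-length; All-resp-↭; Any-resp-↭; map⁺)
open import Data.Nat using (ℕ; _+_; _≤_)
open import Data.Nat.ListAction using (sum)
open import Data.Nat.ListAction.Properties using (sum-++; sum-↭)
open import Data.Nat.Properties
  using ( ≤-refl; ≤-trans; ≤-reflexive; m≤m+n; m≤n+m; +-mono-≤; +-monoˡ-≤; +-assoc
        ; m+n≤o⇒m≤o; <⇒≱; n<1+n)
open import Data.Product using (Σ; ∃; _×_; _,_; proj₁; proj₂)
open import Data.Sum using (_⊎_; inj₁; inj₂)
open import Function using (_∘′_)
open import Relation.Nullary using (¬_)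
open import Relation.Binary.PropositionalEquality
  using (_≡_; _≢_; refl; sym; trans; cong; cong₂; subst; module ≡-Reasoning)

module _ {a} {A : Set a} where

  ↭-─ : ∀ {x : A} {ys} (x∈ys : x ∈ ys) → ys ↭ x ∷ (ys ─ x∈ys)
  ↭-─ (here refl) = ↭-refl
  ↭-─ {ys = y ∷ ys} (there x∈ys) = ↭-trans (prep y (↭-─ x∈ys)) (swap y _ ↭-refl)

  ∷-↭-inv : ∀ {x : A} {xs ys} → x ∷ xs ↭ ys → Σ (x ∈ ys) λ x∈ys → xs ↭ ys ─ x∈ys
  ∷-↭-inv p = x∈ys , drop-∷ (↭-trans p (↭-─ x∈ys))
    where x∈ys = ∈-resp-↭ p (here refl)

absent : ∀ {b} → b ≡ false → b ≢ true
absent refl ()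

record Invariant (S : System) (I : Sequent → Set) : Set where
  field
    resp-↭ : ∀ {Γ Δ} → Γ ↭ Δ → I Γ → I Δ
    axiom  : ∀ n → I (lit n true ∷ lit n false ∷ [])
    step   : ∀ {r ps c} → S r ≡ true → Instance r ps c → All I ps → I c

  holds : ∀ {Γ} → Der S [] Γ → I Γ
  holdsAll : ∀ {Γs} → AllDer S [] Γs → All I Γs
  holds (leaf ())
  holds (perm p d)       = resp-↭ p (holds d)
  holds (ax n)           = axiom n
  holds (rule e inst ds) = step e inst (holdsAll ds)
  holdsAll []       = []
  holdsAll (d ∷ ds) = holds d ∷ holdsAll ds

  incomplete : ∀ {F} → Valid F → ¬ I (F ∷ []) → ¬ Complete S
  incomplete valid ¬I complete = ¬I (holds (complete _ valid))

record GuardedInvariant (S : System) (R C : Sequent → Set) : Set where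
  field
    guard-↭         : ∀ {Γ Δ} → Γ ↭ Δ → R Γ → R Δ
    guard-inherited : ∀ {r ps c} → S r ≡ true → Instance r ps c → R c → All R ps
    resp-↭          : ∀ {Γ Δ} → Γ ↭ Δ → C Γ → C Δ
    axiom           : ∀ n → C (lit n true ∷ lit n false ∷ [])
    step            : ∀ {r ps c} → S r ≡ true → Instance r ps c → R c → All C ps → C c

  invariant : Invariant S (λ Γ → R Γ → C Γ)
  invariant = record
    { resp-↭ = λ p I r → resp-↭ p (I (guard-↭ (↭-sym p) r))
    ; axiom  = λ n _ → axiom n
    ; step   = λ e inst Is r →
        step e inst r (All.zipWith (λ (I , r′) → I r′) (Is , guard-inherited e inst r))
    }

record SubformulaClosed (Q : Formula → Set) : Set where
  field
    ⋀⁻ : ∀ {A B} → Q (A ⋀ B) → Q A × Q B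
    ⋁⁻ : ∀ {A B} → Q (A ⋁ B) → Q A × Q B

premises-inherit : ∀ {Q r ps c} → SubformulaClosed Q → Instance r ps c →
                   All Q c → All (All Q) ps
premises-inherit Q (i-with Γ A B) (qAB ∷ qΓ) with qA , qB ← SubformulaClosed.⋀⁻ Q qAB =
  (qA ∷ qΓ) ∷ (qB ∷ qΓ) ∷ []
premises-inherit Q (i-tensor Δ Σ A B) (qAB ∷ qΔΣ) with qA , qB ← SubformulaClosed.⋀⁻ Q qAB =
  (qA ∷ ++⁻ˡ Δ qΔΣ) ∷ (qB ∷ ++⁻ʳ Δ qΔΣ) ∷ []
premises-inherit Q (i-plus₁ Γ A₁ A₂) (qA ∷ qΓ) with qA₁ , _ ← SubformulaClosed.⋁⁻ Q qA =
  (qA₁ ∷ qΓ) ∷ []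
premises-inherit Q (i-plus₂ Γ A₁ A₂) (qA ∷ qΓ) with _ , qA₂ ← SubformulaClosed.⋁⁻ Q qA =
  (qA₂ ∷ qΓ) ∷ []
premises-inherit Q (i-par Γ A B) (qAB ∷ qΓ) with qA , qB ← SubformulaClosed.⋁⁻ Q qAB =
  (qA ∷ qB ∷ qΓ) ∷ []
premises-inherit Q (i-weak Γ A) (_ ∷ qΓ) = qΓ ∷ []
premises-inherit Q (i-contr Γ A) (qA ∷ qΓ) = (qA ∷ qA ∷ qΓ) ∷ []

data Literal : Formula → Set where
  literal : ∀ n b → Literal (lit n b)

neg-involutive : ∀ A → neg (neg A) ≡ A
neg-involutive (lit n b) = cong (lit n) (not-involutive b)
neg-involutive (A ⋀ B)   = cong₂ _⋀_ (neg-involutive A) (neg-involutive B)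
neg-involutive (A ⋁ B)   = cong₂ _⋁_ (neg-involutive A) (neg-involutive B)

neg-injective : ∀ {A B} → neg A ≡ neg B → A ≡ B
neg-injective {A} {B} eq = begin
  A             ≡⟨ neg-involutive A ⟨
  neg (neg A)   ≡⟨ cong neg eq ⟩
  neg (neg B)   ≡⟨ neg-involutive B ⟩
  B             ∎
  where open ≡-Reasoning

neg-no-fixpoint : ∀ A → A ≢ neg A
neg-no-fixpoint (lit n true)  ()
neg-no-fixpoint (lit n false) ()
neg-no-fixpoint (A ⋀ B)       ()
neg-no-fixpoint (A ⋁ B)       ()

Complementary : Sequent → Set
Complementary Γ = ∃ λ n → Γ ↭ lit n true ∷ lit n false ∷ []

complementary-↭ : ∀ {Γ Δ} → Γ ↭ Δ → Complementary Γ → Complementary Δ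
complementary-↭ p (n , q) = n , ↭-trans (↭-sym p) q

complementary-∷-inv : ∀ {A Γ} → Complementary (A ∷ Γ) → Literal A × Γ ≡ [ neg A ]
complementary-∷-inv (n , p) with ∷-↭-inv p
... | here refl         , q = literal n true  , ↭-singleton-inv q
... | there (here refl) , q = literal n false , ↭-singleton-inv q

complementary-unique : ∀ {A B Γ} → Complementary (A ∷ Γ) → Complementary (B ∷ Γ) → A ≡ B
complementary-unique cA cB
  with _ , eA ← complementary-∷-inv cA | _ , eB ← complementary-∷-inv cB =
  neg-injective (∷-injectiveˡ (trans (sym eA) eB))

complementary-distinct : ∀ {A Γ} → ¬ Complementary (A ∷ A ∷ Γ)
complementary-distinct {A} c with _ , eq ← complementary-∷-inv c =
  neg-no-fixpoint A (∷-injectiveˡ eq)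

complementary-singleton : ∀ {A} → ¬ Complementary [ A ]
complementary-singleton c with _ , () ← complementary-∷-inv c

size : Formula → ℕ
size (lit _ _) = 1
size (A ⋀ B)   = size A + size B
size (A ⋁ B)   = size A + size B

sizeₛ : Sequent → ℕ
sizeₛ Γ = sum (map size Γ)

sizeₛ-↭ : ∀ {Γ Δ} → Γ ↭ Δ → sizeₛ Γ ≡ sizeₛ Δ
sizeₛ-↭ p = sum-↭ (map⁺ size p)

sizeₛ-++ : ∀ Γ Δ → sizeₛ (Γ ++ Δ) ≡ sizeₛ Γ + sizeₛ Δ
sizeₛ-++ Γ Δ = trans (cong sum (map-++ size Γ Δ)) (sum-++ (map size Γ) (map size Δ))

premises-no-larger : ∀ {r ps c} → r ≢ contr → Instance r ps c →
                     All (λ p → sizeₛ p ≤ sizeₛ c) ps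
premises-no-larger _ (i-with Γ A B) =
  +-monoˡ-≤ (sizeₛ Γ) (m≤m+n (size A) (size B)) ∷
  +-monoˡ-≤ (sizeₛ Γ) (m≤n+m (size B) (size A)) ∷ []
premises-no-larger _ (i-tensor Δ Σ A B) rewrite sizeₛ-++ Δ Σ =
  +-mono-≤ (m≤m+n (size A) (size B)) (m≤m+n (sizeₛ Δ) (sizeₛ Σ)) ∷
  +-mono-≤ (m≤n+m (size B) (size A)) (m≤n+m (sizeₛ Σ) (sizeₛ Δ)) ∷ []
premises-no-larger _ (i-plus₁ Γ A₁ A₂) = +-monoˡ-≤ (sizeₛ Γ) (m≤m+n (size A₁) (size A₂)) ∷ []
premises-no-larger _ (i-plus₂ Γ A₁ A₂) = +-monoˡ-≤ (sizeₛ Γ) (m≤n+m (size A₂) (size A₁)) ∷ []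
premises-no-larger _ (i-par Γ A B)     =
  ≤-reflexive (sym (+-assoc (size A) (size B) (sizeₛ Γ))) ∷ []
premises-no-larger _ (i-weak Γ A)      = m≤n+m (sizeₛ Γ) (size A) ∷ []
premises-no-larger ¬contr (i-contr Γ A) = ⊥-elim (¬contr refl)

infix 4 _⊑_

data _⊑_ : Formula → Formula → Set where
  ⊑-refl : ∀ {A} → A ⊑ A
  ⊑-⋀ˡ   : ∀ {A B C} → A ⊑ B → A ⊑ B ⋀ C
  ⊑-⋀ʳ   : ∀ {A B C} → A ⊑ C → A ⊑ B ⋀ C
  ⊑-⋁ˡ   : ∀ {A B C} → A ⊑ B → A ⊑ B ⋁ C
  ⊑-⋁ʳ   : ∀ {A B C} → A ⊑ C → A ⊑ B ⋁ C

⊑-trans : ∀ {A B C} → A ⊑ B → B ⊑ C → A ⊑ C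
⊑-trans s ⊑-refl   = s
⊑-trans s (⊑-⋀ˡ t) = ⊑-⋀ˡ (⊑-trans s t)
⊑-trans s (⊑-⋀ʳ t) = ⊑-⋀ʳ (⊑-trans s t)
⊑-trans s (⊑-⋁ˡ t) = ⊑-⋁ˡ (⊑-trans s t)
⊑-trans s (⊑-⋁ʳ t) = ⊑-⋁ʳ (⊑-trans s t)

⊑-closed : ∀ F → SubformulaClosed (_⊑ F)
⊑-closed F = record
  { ⋀⁻ = λ s → ⊑-trans (⊑-⋀ˡ ⊑-refl) s , ⊑-trans (⊑-⋀ʳ ⊑-refl) s
  ; ⋁⁻ = λ s → ⊑-trans (⊑-⋁ˡ ⊑-refl) s , ⊑-trans (⊑-⋁ʳ ⊑-refl) s
  }

P P̄ Q Q̄ : Formula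
P = lit 0 true
P̄ = lit 0 false
Q = lit 1 true
Q̄ = lit 1 false

data DNF₂ : Formula → Set where
  term : ∀ {n b m c} → lit n b ≢ lit m c → DNF₂ (lit n b ⋀ lit m c)
  _∨_  : ∀ {A B} → DNF₂ A → DNF₂ B → DNF₂ (A ⋁ B)

LiteralOrDNF₂ : Formula → Set
LiteralOrDNF₂ A = Literal A ⊎ DNF₂ A

literalOrDNF₂-closed : SubformulaClosed LiteralOrDNF₂
literalOrDNF₂-closed = record { ⋀⁻ = ⋀⁻ ; ⋁⁻ = ⋁⁻ }
  where
  ⋀⁻ : ∀ {A B} → LiteralOrDNF₂ (A ⋀ B) → LiteralOrDNF₂ A × LiteralOrDNF₂ B
  ⋀⁻ (inj₂ (term _)) = inj₁ (literal _ _) , inj₁ (literal _ _)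
  ⋁⁻ : ∀ {A B} → LiteralOrDNF₂ (A ⋁ B) → LiteralOrDNF₂ A × LiteralOrDNF₂ B
  ⋁⁻ (inj₂ (d ∨ e)) = inj₂ d , inj₂ e

DNF₂-compound : ∀ {A} → DNF₂ A → ¬ Literal A
DNF₂-compound (term _) ()
DNF₂-compound (_ ∨ _)  ()

complementary-DNF₂ : ∀ {A Γ} → DNF₂ A → ¬ Complementary (A ∷ Γ)
complementary-DNF₂ d c = DNF₂-compound d (proj₁ (complementary-∷-inv c))

DNF₂-invariant : ∀ {S} → S tensor ≡ false → S weak ≡ false →
                 GuardedInvariant S (All LiteralOrDNF₂) Complementary
DNF₂-invariant {S} no-⊗ no-W = record
  { guard-↭         = All-resp-↭
  ; guard-inherited = λ _ → premises-inherit literalOrDNF₂-closed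
  ; resp-↭          = complementary-↭
  ; axiom           = λ n → n , ↭-refl
  ; step            = step
  }
  where
  step : ∀ {r ps c} → S r ≡ true → Instance r ps c → All LiteralOrDNF₂ c →
         All Complementary ps → Complementary c
  step _ (i-with _ _ _) (inj₂ (term A≢B) ∷ _) (cA ∷ cB ∷ []) =
    ⊥-elim (A≢B (complementary-unique cA cB))
  step _ (i-plus₁ _ _ _) (inj₂ (d ∨ _) ∷ _) (c ∷ []) = ⊥-elim (complementary-DNF₂ d c)
  step _ (i-plus₂ _ _ _) (inj₂ (_ ∨ e) ∷ _) (c ∷ []) = ⊥-elim (complementary-DNF₂ e c)
  step _ (i-par _ _ _)   (inj₂ (d ∨ _) ∷ _) (c ∷ []) = ⊥-elim (complementary-DNF₂ d c)
  step _ (i-contr _ _)   _                  (c ∷ []) = ⊥-elim (complementary-distinct c)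
  step e (i-tensor _ _ _ _) _ _ = ⊥-elim (absent no-⊗ e)
  step e (i-weak _ _)       _ _ = ⊥-elim (absent no-W e)

all-minterms : Formula
all-minterms = (P ⋀ Q ⋁ P ⋀ Q̄) ⋁ (P̄ ⋀ Q ⋁ P̄ ⋀ Q̄)

all-minterms-valid : Valid all-minterms
all-minterms-valid ρ with ρ 0 | ρ 1
... | true  | true  = refl
... | true  | false = refl
... | false | true  = refl
... | false | false = refl

⊗W-free⇒incomplete : ∀ {S} → S tensor ≡ false → S weak ≡ false → ¬ Complete S
⊗W-free⇒incomplete no-⊗ no-W =
  Invariant.incomplete (GuardedInvariant.invariant (DNF₂-invariant no-⊗ no-W))
    all-minterms-valid λ I → complementary-singleton (I (inj₂ all-minterms-DNF₂ ∷ []))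
  where
  all-minterms-DNF₂ : DNF₂ all-minterms
  all-minterms-DNF₂ = (term (λ ()) ∨ term (λ ())) ∨ (term (λ ()) ∨ term (λ ()))

_occurs-in_ : Formula → Formula → Set
ℓ occurs-in lit n b = ℓ ≡ lit n b
ℓ occurs-in (A ⋀ B) = ℓ occurs-in A ⊎ ℓ occurs-in B
ℓ occurs-in (A ⋁ B) = ℓ occurs-in A ⊎ ℓ occurs-in B

Occurs : Formula → Sequent → Set
Occurs ℓ = Any (ℓ occurs-in_)

NegationClosed : Sequent → Set
NegationClosed Γ = ∀ {ℓ} → Occurs ℓ Γ → Occurs (neg ℓ) Γ

occurs-head : ∀ {A B Γ ℓ} → (∀ {ℓ} → ℓ occurs-in A → ℓ occurs-in B) →
              Occurs ℓ (A ∷ Γ) → Occurs ℓ (B ∷ Γ)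
occurs-head f (here o)  = here (f o)
occurs-head f (there o) = there o

with-negationClosed : ∀ {A B Γ} → NegationClosed (A ∷ Γ) → NegationClosed (B ∷ Γ) →
                      NegationClosed (A ⋀ B ∷ Γ)
with-negationClosed cA cB (here (inj₁ o)) = occurs-head inj₁ (cA (here o))
with-negationClosed cA cB (here (inj₂ o)) = occurs-head inj₂ (cB (here o))
with-negationClosed cA cB (there o)       = occurs-head inj₁ (cA (there o))

tensor-negationClosed : ∀ {A B} Δ {Σ} → NegationClosed (A ∷ Δ) → NegationClosed (B ∷ Σ) →
                        NegationClosed (A ⋀ B ∷ Δ ++ Σ)
tensor-negationClosed {A} {B} Δ {Σ} cA cB = closed
  where
  left : ∀ {ℓ} → Occurs ℓ (A ∷ Δ) → Occurs ℓ (A ⋀ B ∷ Δ ++ Σ)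
  left (here o)  = here (inj₁ o)
  left (there o) = there (++⁺ˡ o)
  right : ∀ {ℓ} → Occurs ℓ (B ∷ Σ) → Occurs ℓ (A ⋀ B ∷ Δ ++ Σ)
  right (here o)  = here (inj₂ o)
  right (there o) = there (++⁺ʳ Δ o)
  closed : NegationClosed (A ⋀ B ∷ Δ ++ Σ)
  closed (here (inj₁ o)) = left (cA (here o))
  closed (here (inj₂ o)) = right (cB (here o))
  closed (there o) with ++⁻ Δ o
  ... | inj₁ o′ = left (cA (there o′))
  ... | inj₂ o′ = right (cB (there o′))

par-negationClosed : ∀ {A B Γ} → NegationClosed (A ∷ B ∷ Γ) → NegationClosed ((A ⋁ B) ∷ Γ)
par-negationClosed {A} {B} {Γ} c = closed
  where
  merge : ∀ {ℓ} → Occurs ℓ (A ∷ B ∷ Γ) → Occurs ℓ ((A ⋁ B) ∷ Γ)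
  merge (here o)          = here (inj₁ o)
  merge (there (here o))  = here (inj₂ o)
  merge (there (there o)) = there o
  closed : NegationClosed ((A ⋁ B) ∷ Γ)
  closed (here (inj₁ o)) = merge (c (here o))
  closed (here (inj₂ o)) = merge (c (there (here o)))
  closed (there o)       = merge (c (there (there o)))

contr-negationClosed : ∀ {A Γ} → NegationClosed (A ∷ A ∷ Γ) → NegationClosed (A ∷ Γ)
contr-negationClosed {A} {Γ} c = closed
  where
  merge : ∀ {ℓ} → Occurs ℓ (A ∷ A ∷ Γ) → Occurs ℓ (A ∷ Γ)
  merge (here o)          = here o
  merge (there (here o))  = here o
  merge (there (there o)) = there o
  closed : NegationClosed (A ∷ Γ)
  closed (here o)  = merge (c (here o))
  closed (there o) = merge (c (there (there o)))

negationClosed-invariant : ∀ {S} → S plus ≡ false → S weak ≡ false → Invariant S NegationClosed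
negationClosed-invariant {S} no-⊕ no-W = record
  { resp-↭ = λ p c o → Any-resp-↭ p (c (Any-resp-↭ (↭-sym p) o))
  ; axiom  = axiom
  ; step   = step
  }
  where
  axiom : ∀ n → NegationClosed (lit n true ∷ lit n false ∷ [])
  axiom n (here refl)         = there (here refl)
  axiom n (there (here refl)) = here refl
  step : ∀ {r ps c} → S r ≡ true → Instance r ps c → All NegationClosed ps → NegationClosed c
  step _ (i-with _ _ _)     (cA ∷ cB ∷ []) = with-negationClosed cA cB
  step _ (i-tensor Δ _ _ _) (cA ∷ cB ∷ []) = tensor-negationClosed Δ cA cB
  step _ (i-par _ _ _)      (c ∷ [])       = par-negationClosed c
  step _ (i-contr _ _)      (c ∷ [])       = contr-negationClosed c
  step e (i-plus₁ _ _ _) _ = ⊥-elim (absent no-⊕ e)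
  step e (i-plus₂ _ _ _) _ = ⊥-elim (absent no-⊕ e)
  step e (i-weak _ _)    _ = ⊥-elim (absent no-W e)

P⋁P̄⋁Q : Formula
P⋁P̄⋁Q = P ⋁ P̄ ⋁ Q

P⋁P̄⋁Q-valid : Valid P⋁P̄⋁Q
P⋁P̄⋁Q-valid ρ with ρ 0
... | true  = refl
... | false = refl

⊕W-free⇒incomplete : ∀ {S} → S plus ≡ false → S weak ≡ false → ¬ Complete S
⊕W-free⇒incomplete no-⊕ no-W =
  Invariant.incomplete (negationClosed-invariant no-⊕ no-W) P⋁P̄⋁Q-valid
    λ c → Q̄-absent (c (here (inj₂ (inj₂ refl))))
  where
  Q̄-absent : ¬ Occurs Q̄ (P⋁P̄⋁Q ∷ [])
  Q̄-absent (here (inj₁ ()))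
  Q̄-absent (here (inj₂ (inj₁ ())))
  Q̄-absent (here (inj₂ (inj₂ ())))

P̄⋀Q̄ P̄⋀P̄⋀Q̄ Q⋁P̄⋀P̄⋀Q̄ P⋁Q⋁P̄⋀P̄⋀Q̄ : Formula
P̄⋀Q̄         = P̄ ⋀ Q̄
P̄⋀P̄⋀Q̄       = P̄ ⋀ P̄⋀Q̄
Q⋁P̄⋀P̄⋀Q̄     = Q ⋁ P̄⋀P̄⋀Q̄
P⋁Q⋁P̄⋀P̄⋀Q̄   = P ⋁ Q⋁P̄⋀P̄⋀Q̄

P⋁Q⋁P̄⋀P̄⋀Q̄-valid : Valid P⋁Q⋁P̄⋀P̄⋀Q̄
P⋁Q⋁P̄⋀P̄⋀Q̄-valid ρ with ρ 0 | ρ 1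
... | true  | _     = refl
... | false | true  = refl
... | false | false = refl

Small : Sequent → Set
Small Γ = All (_⊑ P⋁Q⋁P̄⋀P̄⋀Q̄) Γ × sizeₛ Γ ≤ size P⋁Q⋁P̄⋀P̄⋀Q̄

data Basic (Γ : Sequent) : Set where
  axiom : Complementary Γ → Basic Γ
  by-⊕  : Γ ↭ Q̄ ∷ Q⋁P̄⋀P̄⋀Q̄ ∷ [] → Basic Γ
  by-⊗  : Γ ↭ P ∷ Q ∷ P̄⋀Q̄ ∷ [] → Basic Γ

basic-↭ : ∀ {Γ Δ} → Γ ↭ Δ → Basic Γ → Basic Δ
basic-↭ p (axiom c) = axiom (complementary-↭ p c)
basic-↭ p (by-⊕ q)  = by-⊕ (↭-trans (↭-sym p) q)
basic-↭ p (by-⊗ q)  = by-⊗ (↭-trans (↭-sym p) q)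

basic-P : ∀ {Γ} → Basic (P ∷ Γ) → Γ ≡ [ P̄ ] ⊎ Γ ↭ Q ∷ P̄⋀Q̄ ∷ []
basic-P (axiom c) = inj₁ (proj₂ (complementary-∷-inv c))
basic-P (by-⊕ p) with ∷-↭-inv p
... | here () , _
... | there (here ()) , _
basic-P (by-⊗ p) with ∷-↭-inv p
... | here refl , q = inj₂ q
... | there (here ()) , _
... | there (there (here ())) , _

basic-P̄ : ∀ {Γ} → Basic (P̄ ∷ Γ) → Γ ≡ [ P ]
basic-P̄ (axiom c) = proj₂ (complementary-∷-inv c)
basic-P̄ (by-⊕ p) with ∷-↭-inv p
... | here () , _
... | there (here ()) , _
basic-P̄ (by-⊗ p) with ∷-↭-inv p
... | here () , _
... | there (here ()) , _
... | there (there (here ())) , _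

basic-Q : ∀ {Γ} → Basic (Q ∷ Γ) → Γ ≡ [ Q̄ ] ⊎ Γ ↭ P ∷ P̄⋀Q̄ ∷ []
basic-Q (axiom c) = inj₁ (proj₂ (complementary-∷-inv c))
basic-Q (by-⊕ p) with ∷-↭-inv p
... | here () , _
... | there (here ()) , _
basic-Q (by-⊗ p) with ∷-↭-inv p
... | here () , _
... | there (here refl) , q = inj₂ q
... | there (there (here ())) , _

basic-Q̄ : ∀ {Γ} → Basic (Q̄ ∷ Γ) → Γ ≡ [ Q ] ⊎ Γ ≡ [ Q⋁P̄⋀P̄⋀Q̄ ]
basic-Q̄ (axiom c) = inj₁ (proj₂ (complementary-∷-inv c))
basic-Q̄ (by-⊕ p) with ∷-↭-inv p
... | here refl , q = inj₂ (↭-singleton-inv q)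
... | there (here ()) , _
basic-Q̄ (by-⊗ p) with ∷-↭-inv p
... | here () , _
... | there (here ()) , _
... | there (there (here ())) , _

basic-P̄⋀Q̄ : ∀ {Γ} → Basic (P̄⋀Q̄ ∷ Γ) → Γ ↭ P ∷ Q ∷ []
basic-P̄⋀Q̄ (axiom c) with () ← proj₁ (complementary-∷-inv c)
basic-P̄⋀Q̄ (by-⊕ p) with ∷-↭-inv p
... | here () , _
... | there (here ()) , _
basic-P̄⋀Q̄ (by-⊗ p) with ∷-↭-inv p
... | here () , _
... | there (here ()) , _
... | there (there (here refl)) , q = q

basic-P̄⋀P̄⋀Q̄ : ∀ {Γ} → ¬ Basic (P̄⋀P̄⋀Q̄ ∷ Γ)
basic-P̄⋀P̄⋀Q̄ (axiom c) with () ← proj₁ (complementary-∷-inv c)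
basic-P̄⋀P̄⋀Q̄ (by-⊕ p) with ∷-↭-inv p
... | here () , _
... | there (here ()) , _
basic-P̄⋀P̄⋀Q̄ (by-⊗ p) with ∷-↭-inv p
... | here () , _
... | there (here ()) , _
... | there (there (here ())) , _

basic-Q⋁P̄⋀P̄⋀Q̄ : ∀ {Γ} → Basic (Q⋁P̄⋀P̄⋀Q̄ ∷ Γ) → Γ ≡ [ Q̄ ]
basic-Q⋁P̄⋀P̄⋀Q̄ (axiom c) with () ← proj₁ (complementary-∷-inv c)
basic-Q⋁P̄⋀P̄⋀Q̄ (by-⊕ p) with ∷-↭-inv p
... | here () , _
... | there (here refl) , q = ↭-singleton-inv q
basic-Q⋁P̄⋀P̄⋀Q̄ (by-⊗ p) with ∷-↭-inv p
... | here () , _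
... | there (here ()) , _
... | there (there (here ())) , _

⋁-⋢-P̄⋀P̄⋀Q̄ : ∀ {A B} → ¬ A ⋁ B ⊑ P̄⋀P̄⋀Q̄
⋁-⋢-P̄⋀P̄⋀Q̄ (⊑-⋀ˡ ())
⋁-⋢-P̄⋀P̄⋀Q̄ (⊑-⋀ʳ (⊑-⋀ˡ ()))
⋁-⋢-P̄⋀P̄⋀Q̄ (⊑-⋀ʳ (⊑-⋀ʳ ()))

oversized : ∀ {n} → ¬ 6 + n ≤ 5
oversized h = <⇒≱ (n<1+n 5) (m+n≤o⇒m≤o 6 h)

basic-invariant : ∀ {S} → S contr ≡ false → S weak ≡ false → GuardedInvariant S Small Basic
basic-invariant {S} no-C no-W = record
  { guard-↭         = λ p (sub , small) → All-resp-↭ p sub , subst (_≤ 5) (sizeₛ-↭ p) small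
  ; guard-inherited = λ e inst (sub , small) → All.zip
      ( premises-inherit (⊑-closed P⋁Q⋁P̄⋀P̄⋀Q̄) inst sub
      , All.map (λ le → ≤-trans le small) (premises-no-larger (λ { refl → absent no-C e }) inst))
  ; resp-↭          = basic-↭
  ; axiom           = λ n → axiom (n , ↭-refl)
  ; step            = step
  }
  where
  step : ∀ {r ps c} → S r ≡ true → Instance r ps c → Small c → All Basic ps → Basic c
  step _ (i-with _ _ _) (⊑-⋁ʳ (⊑-⋁ʳ (⊑-⋀ʳ ⊑-refl)) ∷ _ , _) (b₁ ∷ b₂ ∷ [])
    with refl ← basic-P̄ b₁ | basic-Q̄ b₂
  ... | inj₁ ()
  ... | inj₂ ()
  step _ (i-with _ _ _) (⊑-⋁ʳ (⊑-⋁ʳ ⊑-refl) ∷ _ , _) (b₁ ∷ b₂ ∷ [])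
    with refl ← basic-P̄ b₁ | ↭-length (basic-P̄⋀Q̄ b₂)
  ... | ()
  step _ (i-tensor _ _ _ _) (⊑-⋁ʳ (⊑-⋁ʳ (⊑-⋀ʳ ⊑-refl)) ∷ _ , small) (b₁ ∷ b₂ ∷ [])
    with refl ← basic-P̄ b₁ | basic-Q̄ b₂
  ... | inj₁ refl = by-⊗ (↭-trans (swap _ _ ↭-refl) (prep P (swap _ _ ↭-refl)))
  ... | inj₂ refl = ⊥-elim (oversized small)
  step _ (i-tensor _ _ _ _) (⊑-⋁ʳ (⊑-⋁ʳ ⊑-refl) ∷ _ , small) (b₁ ∷ b₂ ∷ [])
    with refl ← basic-P̄ b₁ =
    ⊥-elim (oversized (subst (_≤ 5) (sizeₛ-↭ (prep P̄⋀P̄⋀Q̄ (prep P (basic-P̄⋀Q̄ b₂)))) small))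
  step _ (i-plus₁ _ _ _) (⊑-⋁ʳ ⊑-refl ∷ _ , small) (b ∷ []) with basic-Q b
  ... | inj₁ refl = by-⊕ (swap _ _ ↭-refl)
  ... | inj₂ p    = ⊥-elim (oversized (subst (_≤ 5) (sizeₛ-↭ (prep Q⋁P̄⋀P̄⋀Q̄ p)) small))
  step _ (i-plus₂ _ _ _) (⊑-⋁ʳ ⊑-refl ∷ _ , _) (b ∷ []) = ⊥-elim (basic-P̄⋀P̄⋀Q̄ b)
  step _ (i-par _ _ _)   (⊑-⋁ʳ ⊑-refl ∷ _ , _) (b ∷ []) =
    ⊥-elim (basic-P̄⋀P̄⋀Q̄ (basic-↭ (swap _ _ ↭-refl) b))
  step _ (i-plus₁ _ _ _) (⊑-refl ∷ _ , small) (b ∷ []) with basic-P b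
  ... | inj₁ refl = ⊥-elim (oversized small)
  ... | inj₂ p    = ⊥-elim (oversized (subst (_≤ 5) (sizeₛ-↭ (prep P⋁Q⋁P̄⋀P̄⋀Q̄ p)) small))
  step _ (i-plus₂ _ _ _) (⊑-refl ∷ _ , small) (b ∷ []) with refl ← basic-Q⋁P̄⋀P̄⋀Q̄ b =
    ⊥-elim (oversized small)
  step _ (i-par _ _ _)   (⊑-refl ∷ _ , _) (b ∷ [])
    with () ← basic-Q⋁P̄⋀P̄⋀Q̄ (basic-↭ (swap _ _ ↭-refl) b)
  step _ (i-plus₁ _ _ _) (⊑-⋁ʳ (⊑-⋁ʳ s) ∷ _ , _) _ = ⊥-elim (⋁-⋢-P̄⋀P̄⋀Q̄ s)
  step _ (i-plus₂ _ _ _) (⊑-⋁ʳ (⊑-⋁ʳ s) ∷ _ , _) _ = ⊥-elim (⋁-⋢-P̄⋀P̄⋀Q̄ s)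
  step _ (i-par _ _ _)   (⊑-⋁ʳ (⊑-⋁ʳ s) ∷ _ , _) _ = ⊥-elim (⋁-⋢-P̄⋀P̄⋀Q̄ s)
  step e (i-contr _ _) _ _ = ⊥-elim (absent no-C e)
  step e (i-weak _ _)  _ _ = ⊥-elim (absent no-W e)

basic-singleton : ∀ {A} → ¬ Basic [ A ]
basic-singleton (axiom c) = complementary-singleton c
basic-singleton (by-⊕ p) with () ← ↭-length p
basic-singleton (by-⊗ p) with () ← ↭-length p

CW-free⇒incomplete : ∀ {S} → S contr ≡ false → S weak ≡ false → ¬ Complete S
CW-free⇒incomplete no-C no-W =
  Invariant.incomplete (GuardedInvariant.invariant (basic-invariant no-C no-W))
    P⋁Q⋁P̄⋀P̄⋀Q̄-valid λ I → basic-singleton (I (⊑-refl ∷ [] , ≤-refl))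

primitive-derivable : ∀ {S r} → S r ≡ true → DerivableRule S r
primitive-derivable {S} has-r prems concl inst = rule has-r inst (leaves prems λ m → m)
  where
  leaves : ∀ Γs → (∀ {Γ} → Γ ∈ Γs → Γ ∈ prems) → AllDer S prems Γs
  leaves []       _   = []
  leaves (Γ ∷ Γs) sub = leaf (sub (here refl)) ∷ leaves Γs (sub ∘′ there)

lemma14 : (S : System) → Complete S → S weak ≡ false → Contains S Pp
lemma14 S complete no-W r r∈Pp =
  primitive-derivable (¬-not λ no-r → missing r r∈Pp no-r complete)
  where
  missing : ∀ r → Pp r ≡ true → S r ≡ false → ¬ Complete S
  missing tensor _ no-⊗ = ⊗W-free⇒incomplete no-⊗ no-W
  missing plus   _ no-⊕ = ⊕W-free⇒incomplete no-⊕ no-W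
  missing contr  _ no-C = CW-free⇒incomplete no-C no-W
  missing with-rule ()
  missing par       ()
  missing weak      ()
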